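{- Let $T$ be a finite tree, let $v\in V(T)$, and suppose $u\in V(T)$ satisfies $f_T(v,u)=\min\{f_T(v,x): x\in V(T)\}$. Then $u$ is a pendant vertex (a vertex of degree $1$) of $T$.
   Context: For vertices $x,y$ of a tree $T$, $f_T(x,y)$ denotes the number of subtrees of $T$ containing both $x$ and $y$. -}

module Defs where

open import Data.Nat using (ℕ)
open import Data.Fin using (Fin)
open import Data.Fin.Subset using (Subset; _∈_) renaming (⊤ to full)
open import Data.List using (List; []; _∷_; _∷ʳ_; length)
open import Data.List.Relation.Unary.Linked using (Linked)
open import Data.List.Relation.Unary.Unique.Propositional using (Unique)
import Data.List.Membership.Propositional as LM
open import Data.Product using (Σ; ∃; _×_)
open import Data.Empty using (⊥)
open import Relation.Nullary using (¬_)
open import Relation.Binary.PropositionalEquality using (_≡_)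
open import Function.Bundles using (_⇔_)

record Graph (n : ℕ) : Set₁ where
  field
    Adj    : Fin n → Fin n → Set
    sym    : ∀ {x y} → Adj x y → Adj y x
    irrefl : ∀ {x} → ¬ Adj x x
open Graph public

module _ {n : ℕ} (G : Graph n) where

  data WalkIn (S : Subset n) : Fin n → Fin n → Set where
    here : ∀ {x} → x ∈ S → WalkIn S x x
    step : ∀ {x y z} → x ∈ S → Adj G x y → WalkIn S y z → WalkIn S x z

  ConnectedOn : Subset n → Set
  ConnectedOn S = ∀ x y → x ∈ S → y ∈ S → WalkIn S x y

  Connected : Set
  Connected = ∀ (x y : Fin n) → WalkIn full x y

  -- a cycle: distinct vertices x,y,z,zs (at least 3), consecutive adjacent, closing back to x
  Acyclic : Set
  Acyclic = ∀ x y z (zs : List (Fin n)) →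
            Unique (x ∷ y ∷ z ∷ zs) → Linked (Adj G) ((x ∷ y ∷ z ∷ zs) ∷ʳ x) → ⊥

  IsTree : Set
  IsTree = Connected × Acyclic

  -- a subtree of a tree is determined by its (nonempty) vertex set, which must
  -- induce a connected subgraph
  IsSubtree : Subset n → Set
  IsSubtree S = (∃ λ x → x ∈ S) × ConnectedOn S

  SubtreeThrough : Fin n → Fin n → Subset n → Set
  SubtreeThrough x y S = IsSubtree S × x ∈ S × y ∈ S

  -- f_T(x,y) ≡ k : the subtrees containing x and y are enumerated without
  -- repetition by a list of length k
  SubtreeCount : Fin n → Fin n → ℕ → Set
  SubtreeCount x y k =
    Σ (List (Subset n)) λ L →
      Unique L × (∀ S → (S LM.∈ L) ⇔ SubtreeThrough x y S) × length L ≡ k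

  Pendant : Fin n → Set
  Pendant u = Σ (Fin n) λ w → Adj G u w × (∀ w' → Adj G u w' → w' ≡ w)

{-# OPTIONS --safe #-}
-- If v = u, any second vertex w gives a subtree through v and u (the singleton) missing w, while every
-- subtree through v and w contains u; filtering by w therefore counts strictly fewer subtrees, so u is not a
-- minimiser. If v ≠ u, let a be the neighbour through which the path from v enters u. For any other
-- neighbour w of u, acyclicity forces every subtree through v and w to contain u, whereas the path from v
-- to u misses w: the same comparison rules w out, so a is the only neighbour of u.
module Submission where

open import Defs
open import Data.Nat using (ℕ; _≤_; _<_; s≤s; z≤n)
open import Data.Nat.Properties using (<⇒≱)
open import Data.Fin using (Fin; zero; _≟_; punchIn)
open import Data.Fin.Properties using (punchInᵢ≢i)
open import Data.Fin.Subset using (Subset) renaming (_∈_ to _∈S_; _∉_ to _∉S_)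
open import Data.Fin.Subset.Properties using (_∈?_)
open import Data.Bool.Properties using (T-≡)
open import Data.Vec using (tabulate)
open import Data.Vec.Properties using (lookup∘tabulate; []=⇒lookup; lookup⇒[]=)
open import Data.List using (List; []; _∷_; _∷ʳ_; length; filter)
open import Data.List.Properties using (filter-notAll)
open import Data.List.Relation.Unary.Linked using (Linked; [-]; _∷_)
open import Data.List.Relation.Unary.Any using (here; there)
import Data.List.Relation.Unary.Any as Any
open import Data.List.Relation.Unary.Any.Properties using (singleton⁻)
open import Data.List.Relation.Unary.All using (All; []; _∷_)
import Data.List.Relation.Unary.All as All
open import Data.List.Relation.Unary.All.Properties.Core using (¬Any⇒All¬)
open import Data.List.Relation.Unary.AllPairs using ([]; _∷_)
open import Data.List.Relation.Unary.Unique.Propositional using (Unique)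
import Data.List.Relation.Unary.Unique.Propositional.Properties as Unique
open import Data.List.Membership.Propositional using () renaming (_∈_ to _∈L_; _∉_ to _∉L_)
open import Data.List.Membership.Propositional.Properties using (∈-filter⁺; ∈-filter⁻)
open import Data.List.Relation.Binary.Subset.Propositional using (_⊆_)
open import Data.Product using (Σ; ∃; ∃₂; _×_; _,_; proj₁; proj₂)
open import Data.Sum using (_⊎_; inj₁; inj₂; [_,_])
open import Data.Empty using (⊥; ⊥-elim)
open import Relation.Nullary using (yes; no)
open import Relation.Nullary.Decidable using (isYes; fromWitness; toWitness)
open import Relation.Binary.PropositionalEquality using (_≡_; _≢_; refl; trans) renaming (sym to ≡-sym)
open import Function using (_∘_; id)
open import Function.Bundles using (_⇔_; mk⇔; Equivalence)

module _ {n : ℕ} (G : Graph n) where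

  open import Data.List.Membership.DecPropositional (_≟_ {n}) using () renaming (_∈?_ to _∈L?_)

  data Walk : Fin n → Fin n → Set where
    []  : ∀ {x} → Walk x x
    _∷_ : ∀ {x y z} → Adj G x y → Walk y z → Walk x z

  laterVertices : ∀ {x z} → Walk x z → List (Fin n)
  laterVertices []                = []
  laterVertices (_∷_ {y = y} _ w) = y ∷ laterVertices w

  -- Splitting off the source definitionally exposes the first vertices of a cycle built from a walk.
  vertices : ∀ {x z} → Walk x z → List (Fin n)
  vertices {x} w = x ∷ laterVertices w

  _++ʷ_ : ∀ {x y z} → Walk x y → Walk y z → Walk x z
  []      ++ʷ q = q
  (e ∷ p) ++ʷ q = e ∷ (p ++ʷ q)

  ∈-vertices-++ʷ : ∀ {x y z} (p : Walk x y) (q : Walk y z) {t} →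
                   t ∈L vertices (p ++ʷ q) → t ∈L vertices p ⊎ t ∈L vertices q
  ∈-vertices-++ʷ []      q t∈         = inj₂ t∈
  ∈-vertices-++ʷ (e ∷ p) q (here t≡x) = inj₁ (here t≡x)
  ∈-vertices-++ʷ (e ∷ p) q (there t∈) = [ inj₁ ∘ there , inj₂ ] (∈-vertices-++ʷ p q t∈)

  target∈vertices : ∀ {x z} (w : Walk x z) → z ∈L vertices w
  target∈vertices []      = here refl
  target∈vertices (e ∷ w) = there (target∈vertices w)

  dropUntil : ∀ {x y z} (w : Walk y z) → x ∈L vertices w → Walk x z
  dropUntil []      (here refl) = []
  dropUntil (e ∷ w) (here refl) = e ∷ w
  dropUntil (e ∷ w) (there x∈)  = dropUntil w x∈

  dropUntil-⊆ : ∀ {x y z} (w : Walk y z) (x∈ : x ∈L vertices w) →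
                vertices (dropUntil w x∈) ⊆ vertices w
  dropUntil-⊆ []      (here refl) = id
  dropUntil-⊆ (e ∷ w) (here refl) = id
  dropUntil-⊆ (e ∷ w) (there x∈)  = there ∘ dropUntil-⊆ w x∈

  dropUntil-unique : ∀ {x y z} (w : Walk y z) (x∈ : x ∈L vertices w) →
                     Unique (vertices w) → Unique (vertices (dropUntil w x∈))
  dropUntil-unique []      (here refl) w!       = w!
  dropUntil-unique (e ∷ w) (here refl) w!       = w!
  dropUntil-unique (e ∷ w) (there x∈)  (_ ∷ w!) = dropUntil-unique w x∈ w!

  loopErase : ∀ {x z} (w : Walk x z) →
              Σ (Walk x z) λ p → Unique (vertices p) × vertices p ⊆ vertices w
  loopErase []            = [] , [] ∷ [] , id
  loopErase (_∷_ {x} e w) with loopErase w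
  ... | p , p! , p⊆ with x ∈L? vertices p
  ...   | yes x∈p = dropUntil p x∈p , dropUntil-unique p x∈p p! , there ∘ p⊆ ∘ dropUntil-⊆ p x∈p
  ...   | no  x∉p = e ∷ p , ¬Any⇒All¬ _ x∉p ∷ p! ,
                    λ { (here t≡x) → here t≡x ; (there t∈) → there (p⊆ t∈) }

  linked-vertices : ∀ {x z t} (w : Walk x z) → Adj G z t → Linked (Adj G) (vertices w ∷ʳ t)
  linked-vertices []          z~t = z~t ∷ [-]
  linked-vertices (e ∷ [])    z~t = e ∷ z~t ∷ [-]
  linked-vertices (e ∷ f ∷ w) z~t = e ∷ linked-vertices (f ∷ w) z~t

  firstEntry : ∀ {x u} → Walk x u → x ≢ u →
               ∃₂ λ a (q : Walk x a) → u ∉L vertices q × Adj G a u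
  firstEntry []                       x≢u = ⊥-elim (x≢u refl)
  firstEntry {x} {u} (_∷_ {y = y} e w) x≢u with y ≟ u
  ... | yes refl = x , [] , (λ { (here u≡x) → x≢u (≡-sym u≡x) }) , e
  ... | no  y≢u with firstEntry w y≢u
  ...   | a , q , u∉q , a~u =
          a , e ∷ q , (λ { (here u≡x) → x≢u (≡-sym u≡x) ; (there u∈q) → u∉q u∈q }) , a~u

  no-bypass : Acyclic G → ∀ {w a u} → Adj G u w → Adj G a u → w ≢ a →
              (r : Walk w a) → u ∉L vertices r → ⊥
  no-bypass acyclic {w} {u = u} u~w a~u w≢a r u∉r with loopErase r
  ... | []    , _  , _  = w≢a refl
  ... | e ∷ p , p! , p⊆ =
        acyclic u w _ (laterVertices p) (¬Any⇒All¬ _ (u∉r ∘ p⊆) ∷ p!) (u~w ∷ linked-vertices (e ∷ p) a~u)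

  walkIn-source : ∀ {S x y} → WalkIn G S x y → x ∈S S
  walkIn-source (WalkIn.here x∈)     = x∈
  walkIn-source (WalkIn.step x∈ _ _) = x∈

  _++ᵂ_ : ∀ {S x y z} → WalkIn G S x y → WalkIn G S y z → WalkIn G S x z
  WalkIn.here _      ++ᵂ q = q
  WalkIn.step x∈ e p ++ᵂ q = WalkIn.step x∈ e (p ++ᵂ q)

  reverseᵂ : ∀ {S x y} → WalkIn G S x y → WalkIn G S y x
  reverseᵂ (WalkIn.here x∈)     = WalkIn.here x∈
  reverseᵂ (WalkIn.step x∈ e p) = reverseᵂ p ++ᵂ WalkIn.step (walkIn-source p) (Graph.sym G e) (WalkIn.here x∈)

  fromWalkIn : ∀ {S x y} → WalkIn G S x y → Σ (Walk x y) λ w → All (_∈S S) (vertices w)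
  fromWalkIn (WalkIn.here x∈) = [] , x∈ ∷ []
  fromWalkIn (WalkIn.step x∈ e p) with fromWalkIn p
  ... | w , w⊆S = e ∷ w , x∈ ∷ w⊆S

  toWalkIn : ∀ {S x y} (w : Walk x y) → All (_∈S S) (vertices w) → WalkIn G S x y
  toWalkIn []      (x∈ ∷ _)    = WalkIn.here x∈
  toWalkIn (e ∷ w) (x∈ ∷ w⊆S) = WalkIn.step x∈ e (toWalkIn w w⊆S)

  fromList : List (Fin n) → Subset n
  fromList vs = tabulate (λ t → isYes (t ∈L? vs))

  ∈-fromList⁺ : ∀ {vs t} → t ∈L vs → t ∈S fromList vs
  ∈-fromList⁺ {vs} {t} t∈ =
    lookup⇒[]= t _ (trans (lookup∘tabulate _ t) (Equivalence.to T-≡ (fromWitness t∈)))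

  ∈-fromList⁻ : ∀ {vs t} → t ∈S fromList vs → t ∈L vs
  ∈-fromList⁻ {vs} {t} t∈ =
    toWitness (Equivalence.from T-≡ (trans (≡-sym (lookup∘tabulate _ t)) ([]=⇒lookup t∈)))

  vertices-isSubtree : ∀ {x z} (w : Walk x z) → IsSubtree G (fromList (vertices w))
  vertices-isSubtree {x} w = (x , ∈-fromList⁺ (here refl)) , connected
    where
    toTarget : ∀ {t} (t∈ : t ∈L vertices w) → WalkIn G (fromList (vertices w)) t _
    toTarget t∈ = toWalkIn (dropUntil w t∈) (All.tabulate (∈-fromList⁺ ∘ dropUntil-⊆ w t∈))

    connected : ConnectedOn G (fromList (vertices w))
    connected s t s∈ t∈ = toTarget (∈-fromList⁻ s∈) ++ᵂ reverseᵂ (toTarget (∈-fromList⁻ t∈))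

  -- Filtering an enumeration of the subtrees through v and u by "contains w" enumerates those through v and w.
  fewerSubtreesThrough : ∀ {v u w m} → SubtreeCount G v u m →
                         (∀ S → SubtreeThrough G v w S → u ∈S S) →
                         ∀ S → SubtreeThrough G v u S → w ∉S S →
                         ∃ λ k → SubtreeCount G v w k × k < m
  fewerSubtreesThrough {v} {w = w} (L , L! , L⇔ , refl) w⇒u S S-through w∉S =
    length Lʷ , (Lʷ , Unique.filter⁺ (w ∈?_) L! , Lʷ⇔ , refl) ,
    filter-notAll (w ∈?_) L (Any.map (λ { refl → w∉S }) (Equivalence.from (L⇔ S) S-through))
    where
    Lʷ : List (Subset n)
    Lʷ = filter (w ∈?_) L

    Lʷ⇔ : ∀ T → (T ∈L Lʷ) ⇔ SubtreeThrough G v w T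
    Lʷ⇔ T = mk⇔
      (λ T∈ → let (T∈L , w∈T) = ∈-filter⁻ (w ∈?_) T∈
                  (T-subtree , v∈T , _) = Equivalence.to (L⇔ T) T∈L
              in T-subtree , v∈T , w∈T)
      (λ T-through@(T-subtree , v∈T , w∈T) →
         ∈-filter⁺ (w ∈?_) (Equivalence.from (L⇔ T) (T-subtree , v∈T , w⇒u T T-through)) w∈T)

  minimiser-dominated : ∀ {v u w m} → SubtreeCount G v u m →
                        (∀ x k → SubtreeCount G v x k → m ≤ k) →
                        (∀ S → SubtreeThrough G v w S → u ∈S S) →
                        ∀ S → SubtreeThrough G v u S → w ∈S S
  minimiser-dominated count minimal w⇒u S S-through with _ ∈? S
  ... | yes w∈S = w∈S
  ... | no  w∉S with fewerSubtreesThrough count w⇒u S S-through w∉S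
  ...   | k , countʷ , k<m = ⊥-elim (<⇒≱ k<m (minimal _ k countʷ))

  root-minimiser⇒trivial : ∀ {v m} → SubtreeCount G v v m →
                           (∀ x k → SubtreeCount G v x k → m ≤ k) → ∀ w → w ≡ v
  root-minimiser⇒trivial {v} count minimal w =
    singleton⁻ (∈-fromList⁻ (minimiser-dominated count minimal (λ _ → proj₁ ∘ proj₂) _ singleton-through))
    where
    singleton-through : SubtreeThrough G v v (fromList (v ∷ []))
    singleton-through = vertices-isSubtree [] , ∈-fromList⁺ (here refl) , ∈-fromList⁺ (here refl)

  -- q is a walk from v entering u from a; any other neighbour w of u lies behind u as seen from v.
  module Behind (acyclic : Acyclic G) {v a u : Fin n} (q : Walk v a) (u∉q : u ∉L vertices q)
                (a~u : Adj G a u) {w : Fin n} (u~w : Adj G u w) (w≢a : w ≢ a) where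

    behind⇒∈ : ∀ S → SubtreeThrough G v w S → u ∈S S
    behind⇒∈ S ((_ , connected) , v∈S , w∈S) with u ∈? S
    ... | yes u∈S = u∈S
    ... | no  u∉S with fromWalkIn (connected _ _ w∈S v∈S)
    ...   | r , r⊆S = ⊥-elim (no-bypass acyclic u~w a~u w≢a (r ++ʷ q)
                        ([ (λ u∈r → u∉S (All.lookup r⊆S u∈r)) , u∉q ] ∘ ∈-vertices-++ʷ r q))

    approach : Walk v u
    approach = q ++ʷ (a~u ∷ [])

    behind∉approach : w ∉S fromList (vertices approach)
    behind∉approach w∈ with ∈-vertices-++ʷ q (a~u ∷ []) (∈-fromList⁻ w∈)
    ... | inj₁ w∈q                 = no-bypass acyclic u~w a~u w≢a (dropUntil q w∈q) (u∉q ∘ dropUntil-⊆ q w∈q)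
    ... | inj₂ (here w≡a)          = w≢a w≡a
    ... | inj₂ (there (here refl)) = Graph.irrefl G u~w

    approach-through : SubtreeThrough G v u (fromList (vertices approach))
    approach-through =
      vertices-isSubtree approach , ∈-fromList⁺ (here refl) , ∈-fromList⁺ (target∈vertices approach)

mainTheorem8 : (n : ℕ) (G : Graph n) → IsTree G → 2 ≤ n →
               (v u : Fin n) (fu : ℕ) → SubtreeCount G v u fu →
               (∀ (x : Fin n) (k : ℕ) → SubtreeCount G v x k → fu ≤ k) →
               Pendant G u
mainTheorem8 _ G (connected , acyclic) (s≤s (s≤s z≤n)) v u _ count minimal with v ≟ u
... | yes refl = ⊥-elim (punchInᵢ≢i v zero (root-minimiser⇒trivial G count minimal _))
... | no v≢u with firstEntry G (proj₁ (fromWalkIn G (connected v u))) v≢u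
...   | a , q , u∉q , a~u = a , Graph.sym G a~u , onlyNeighbour
  where
  onlyNeighbour : ∀ w → Adj G u w → w ≡ a
  onlyNeighbour w u~w with w ≟ a
  ... | yes w≡a = w≡a
  ... | no  w≢a = ⊥-elim (behind∉approach (minimiser-dominated G count minimal behind⇒∈ _ approach-through))
    where open Behind G acyclic q u∉q a~u u~w w≢a
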